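{- Let $p$ be a prime and let $S\subseteq\mathbb{Z}_{p^2}$ be a generating set of the additive group $\mathbb{Z}_{p^2}$ with $S=-S$ and $0\notin S$. If $|S|<p$ and $xp\notin S$ for all $x\in\mathbb{Z}_p\setminus\{0\}$, then $O\chi(\Gamma(\mathbb{Z}_{p^2},S))=p$.
   Context: For an additive group $G$ and a subset $S\subseteq G$ closed under negation with $0\notin S$, the Cayley graph $\Gamma(G,S)$ has vertex set $G$, with $u$ and $v$ adjacent if and only if $u-v\in S$. All colourings are proper vertex colourings. Two colourings of a graph are orthogonal if whenever two distinct vertices receive the same colour in one colouring, they receive distinct colours in the other. An orthogonal colouring is a pair of orthogonal proper colourings; $O\chi(G)$ is the minimum number of colours needed for an orthogonal colouring of $G$ (both colourings drawing from the same set of that many colours). -}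

module Defs where

open import Data.Nat using (ℕ; zero; suc; _+_; _∸_; _<_)
open import Data.Unit using (⊤)
open import Relation.Nullary using (¬_)
open import Data.Nat.DivMod using (_mod_)
open import Data.Fin using (Fin; toℕ)
import Data.Fin as Fin
open import Data.Fin.Subset using (Subset; _∈_; _∉_)
open import Data.List using (List; []; _∷_)
open import Data.List.Relation.Unary.All using (All)
open import Data.Product using (∃; _×_)
open import Data.Sum using (_⊎_)
open import Relation.Binary.PropositionalEquality using (_≡_; _≢_)

_⊕_ : ∀ {n} → Fin n → Fin n → Fin n
_⊕_ {zero} () b
_⊕_ {suc m} a b = (toℕ a + toℕ b) mod suc m

⊝_ : ∀ {n} → Fin n → Fin n
⊝_ {zero} ()
⊝_ {suc m} a = (suc m ∸ toℕ a) mod suc m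

_⊖_ : ∀ {n} → Fin n → Fin n → Fin n
a ⊖ b = a ⊕ (⊝ b)

sumZ : ∀ {m} → List (Fin (suc m)) → Fin (suc m)
sumZ [] = Fin.zero
sumZ (x ∷ xs) = x ⊕ sumZ xs

SymmetricSet : ∀ {n} → Subset n → Set
SymmetricSet S = ∀ a → a ∈ S → (⊝ a) ∈ S

Generates : ∀ {n} → Subset n → Set
Generates {zero} S = ⊤
Generates {suc m} S =
  ∀ (g : Fin (suc m)) → ∃ λ (xs : List (Fin (suc m))) →
    All (λ x → x ∈ S ⊎ (⊝ x) ∈ S) xs × sumZ xs ≡ g

Adj : ∀ {n} → Subset n → Fin n → Fin n → Set
Adj S u v = (u ⊖ v) ∈ S

Proper : ∀ {n k} → Subset n → (Fin n → Fin k) → Set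
Proper S c = ∀ u v → Adj S u v → c u ≢ c v

Orthogonal : ∀ {n k} → (Fin n → Fin k) → (Fin n → Fin k) → Set
Orthogonal c₁ c₂ = ∀ u v → u ≢ v → c₁ u ≡ c₁ v → c₂ u ≢ c₂ v

HasOrthColouring : ∀ {n} → Subset n → ℕ → Set
HasOrthColouring {n} S k =
  ∃ λ (c₁ : Fin n → Fin k) → ∃ λ (c₂ : Fin n → Fin k) →
    Proper S c₁ × Proper S c₂ × Orthogonal c₁ c₂

OChiEq : ∀ {n} → Subset n → ℕ → Set
OChiEq S k = HasOrthColouring S k × (∀ j → j < k → ¬ HasOrthColouring S j)

-- Write a vertex of ℤ_{p²} in base p as v = a + b·p. The colouring v ↦ a is proper
-- because S contains no multiple of p, and for every slope t the colouring
-- v ↦ b + t·a (mod p) is orthogonal to it, since the two colours recover (a, b).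
-- Adding s = s₀ + s₁·p to v changes b + t·a by s₁ + t·s₀ plus a carry of 0 or 1, and a
-- carry of 1 for s becomes a carry of 0 for −s, because the forms of s and −s sum to −1.
-- So v ↦ b + t·a is proper once s₁ + t·s₀ ≢ 0 for all s ∈ S; as s₀ is invertible mod p,
-- each s rules out a single t, and |S| < p leaves a slope free. Conversely, an
-- orthogonal colouring with j colours injects the p² vertices into j² colour pairs.

module Submission where

open import Defs
open import Data.Empty using (⊥; ⊥-elim)
open import Data.Fin using (Fin; zero; suc; toℕ; combine)
open import Data.Fin.Properties
  using (toℕ-fromℕ<; toℕ<n; toℕ-injective; suc-injective; 0≢1+n; injective⇒≤; combine-injective; any?; all?; ¬∀⟶∃¬)
  renaming (_≟_ to _≟ᶠ_)
open import Data.Fin.Subset using (Subset; _∈_; _∉_; ∣_∣; _-_)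
open import Data.Fin.Subset.Properties using (_∈?_; x∈p∧x≢y⇒x∈p-y; x∈p⇒∣p-x∣<∣p∣)
open import Data.Nat using (ℕ; suc; _+_; _*_; _∸_; _%_; _/_; _≤_; _<_; _≟_; NonZero; z≤n; s≤s)
open import Data.Nat.DivMod
  using (_mod_; m≡m%n+[m/n]*n; m%n%n≡m%n; m%n<n; m%n≤n; m<n⇒m%n≡m; [m+n]%n≡m%n; [m+kn]%n≡m%n; m*n%n≡0;
         %-distribˡ-+; 0/n≡0; m*n/n≡m; +-distrib-/-∣ʳ; m<n*o⇒m/o<n)
open import Data.Nat.Divisibility using (_∣_; n∣m*n; ∣m+n∣m⇒∣n; m%n≡0⇒n∣m; n∣m⇒m%n≡0; >⇒∤)
open import Data.Nat.Primality using (Prime; euclidsLemma; prime⇒nonZero)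
open import Data.Nat.Properties
  using (+-identityʳ; +-comm; +-assoc; +-mono-<; *-zeroʳ; *-assoc; *-mono-<; <⇒≤; <⇒≱; ≤-<-trans; ≤-total;
         n≢0⇒n>0; m≤n+m; m≤n⇒∃[o]m+o≡n; m+n≡0⇒m≡0; m+[n∸m]≡n; m∸n+n≡m; ∸-monoʳ-<; +-commutativeSemigroup)
open import Algebra.Properties.CommutativeSemigroup +-commutativeSemigroup using (xy∙z≈xz∙y; x∙yz≈yx∙z)
open import Data.Nat.Tactic.RingSolver using (solve-∀)
open import Data.Product using (∃; ∃-syntax; _×_; _,_; proj₁; proj₂)
open import Data.Sum using (_⊎_; inj₁; inj₂; [_,_]′)
open import Function using (_∘_)
open import Function.Definitions using (Injective)
open import Relation.Binary.PropositionalEquality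
  using (_≡_; _≢_; refl; sym; trans; cong; cong₂; subst; module ≡-Reasoning)
open import Relation.Nullary using (¬_; Dec; yes; no)
open import Relation.Nullary.Decidable using (_×-dec_)

open ≡-Reasoning

[m%d+n]%d≡[m+n]%d : ∀ m n d .{{_ : NonZero d}} → (m % d + n) % d ≡ (m + n) % d
[m%d+n]%d≡[m+n]%d m n d = begin
  (m % d + n) % d          ≡⟨ %-distribˡ-+ (m % d) n d ⟩
  (m % d % d + n % d) % d  ≡⟨ cong (λ x → (x + n % d) % d) (m%n%n≡m%n m d) ⟩
  (m % d + n % d) % d      ≡⟨ %-distribˡ-+ m n d ⟨
  (m + n) % d              ∎

m+[d∸m%d]≡[1+m/d]*d : ∀ m d .{{_ : NonZero d}} → m + (d ∸ m % d) ≡ suc (m / d) * d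
m+[d∸m%d]≡[1+m/d]*d m d = begin
  m + (d ∸ m % d)                     ≡⟨ cong (_+ (d ∸ m % d)) (m≡m%n+[m/n]*n m d) ⟩
  m % d + m / d * d + (d ∸ m % d)     ≡⟨ cong (_+ (d ∸ m % d)) (+-comm (m % d) (m / d * d)) ⟩
  m / d * d + m % d + (d ∸ m % d)     ≡⟨ +-assoc (m / d * d) (m % d) (d ∸ m % d) ⟩
  m / d * d + (m % d + (d ∸ m % d))   ≡⟨ cong (m / d * d +_) (m+[n∸m]≡n (m%n≤n m d)) ⟩
  m / d * d + d                       ≡⟨ +-comm (m / d * d) d ⟩
  suc (m / d) * d                     ∎

%-cancelʳ-+ : ∀ m n o d .{{_ : NonZero d}} → (m + o) % d ≡ (n + o) % d → m % d ≡ n % d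
%-cancelʳ-+ m n o d eq = begin
  m % d                     ≡⟨ undo m ⟨
  (m + o + c) % d           ≡⟨ [m%d+n]%d≡[m+n]%d (m + o) c d ⟨
  ((m + o) % d + c) % d     ≡⟨ cong (λ x → (x + c) % d) eq ⟩
  ((n + o) % d + c) % d     ≡⟨ [m%d+n]%d≡[m+n]%d (n + o) c d ⟩
  (n + o + c) % d           ≡⟨ undo n ⟩
  n % d                     ∎
  where
  c : ℕ
  c = d ∸ o % d
  undo : ∀ k → (k + o + c) % d ≡ k % d
  undo k = begin
    (k + o + c) % d               ≡⟨ cong (_% d) (+-assoc k o c) ⟩
    (k + (o + c)) % d             ≡⟨ cong (λ x → (k + x) % d) (m+[d∸m%d]≡[1+m/d]*d o d) ⟩
    (k + suc (o / d) * d) % d     ≡⟨ [m+kn]%n≡m%n k (suc (o / d)) d ⟩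
    k % d                         ∎

toℕ-mod : ∀ m n .{{_ : NonZero n}} → toℕ (m mod n) ≡ m % n
toℕ-mod m n = toℕ-fromℕ< (m%n<n m n)

mod-injective : ∀ {m k} n .{{_ : NonZero n}} → m mod n ≡ k mod n → m % n ≡ k % n
mod-injective {m} {k} n eq = trans (sym (toℕ-mod m n)) (trans (cong toℕ eq) (toℕ-mod k n))

toℕ-⊖ : ∀ {n} (u v : Fin n) → ∃[ k ] toℕ (u ⊖ v) + toℕ v ≡ toℕ u + k * n
toℕ-⊖ {suc m} u v = (x / N , trans (m≡m%n+[m/n]*n x N) (cong (_+ x / N * N) x%N≡a))
  where
  N a b x : ℕ
  N = suc m
  a = toℕ u
  b = toℕ v
  x = toℕ (u ⊖ v) + b
  x%N≡a : x % N ≡ a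
  x%N≡a = begin
    (toℕ (u ⊖ v) + b) % N              ≡⟨ cong (λ y → (y + b) % N) (toℕ-mod (a + toℕ (⊝ v)) N) ⟩
    ((a + toℕ (⊝ v)) % N + b) % N      ≡⟨ [m%d+n]%d≡[m+n]%d (a + toℕ (⊝ v)) b N ⟩
    (a + toℕ (⊝ v) + b) % N            ≡⟨ cong (λ y → (a + y + b) % N) (toℕ-mod (N ∸ b) N) ⟩
    (a + (N ∸ b) % N + b) % N          ≡⟨ cong (_% N) (+-assoc a ((N ∸ b) % N) b) ⟩
    (a + ((N ∸ b) % N + b)) % N        ≡⟨ cong (_% N) (+-comm a _) ⟩
    ((N ∸ b) % N + b + a) % N          ≡⟨ cong (_% N) (+-assoc ((N ∸ b) % N) b a) ⟩
    ((N ∸ b) % N + (b + a)) % N        ≡⟨ [m%d+n]%d≡[m+n]%d (N ∸ b) (b + a) N ⟩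
    (N ∸ b + (b + a)) % N              ≡⟨ cong (_% N) (+-assoc (N ∸ b) b a) ⟨
    (N ∸ b + b + a) % N                ≡⟨ cong (λ y → (y + a) % N) (m∸n+n≡m (<⇒≤ (toℕ<n v))) ⟩
    (N + a) % N                        ≡⟨ cong (_% N) (+-comm N a) ⟩
    (a + N) % N                        ≡⟨ [m+n]%n≡m%n a N ⟩
    a % N                              ≡⟨ m<n⇒m%n≡m (toℕ<n u) ⟩
    a                                  ∎

toℕ-⊝ : ∀ {n} (s : Fin n) → toℕ s ≢ 0 → toℕ (⊝ s) + toℕ s ≡ n
toℕ-⊝ {suc m} s s≢0 = begin
  toℕ (⊝ s) + toℕ s          ≡⟨ cong (_+ toℕ s) (toℕ-mod (N ∸ toℕ s) N) ⟩
  (N ∸ toℕ s) % N + toℕ s    ≡⟨ cong (_+ toℕ s) (m<n⇒m%n≡m (∸-monoʳ-< (n≢0⇒n>0 s≢0) s≤N)) ⟩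
  N ∸ toℕ s + toℕ s          ≡⟨ m∸n+n≡m s≤N ⟩
  N                          ∎
  where
  N : ℕ
  N = suc m
  s≤N : toℕ s ≤ N
  s≤N = <⇒≤ (toℕ<n s)

prime∣shift⇒≡0 : ∀ {p a b t d} → Prime p → ¬ p ∣ a → d < p →
                 p ∣ b + t * a → p ∣ b + (t + d) * a → d ≡ 0
prime∣shift⇒≡0 {d = 0} _ _ _ _ _ = refl
prime∣shift⇒≡0 {p} {a} {b} {t} {suc d} pr p∤a d<p p∣x p∣y
  with euclidsLemma (suc d) a pr (∣m+n∣m⇒∣n (subst (p ∣_) (shift b t (suc d) a) p∣y) p∣x)
  where
  shift : ∀ b t d a → b + (t + d) * a ≡ (b + t * a) + d * a
  shift = solve-∀
... | inj₁ p∣d = ⊥-elim (>⇒∤ d<p p∣d)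
... | inj₂ p∣a = ⊥-elim (p∤a p∣a)

affine-root-unique-≤ : ∀ {p} .{{_ : NonZero p}} → Prime p → ∀ {a b t t'} → a % p ≢ 0 → t ≤ t' → t' < p →
                       (b + t * a) % p ≡ 0 → (b + t' * a) % p ≡ 0 → t ≡ t'
affine-root-unique-≤ {p} pr {a} {b} {t} a≢0 t≤t' t'<p root root' with m≤n⇒∃[o]m+o≡n t≤t'
... | d , refl = sym (trans (cong (t +_) d≡0) (+-identityʳ t))
  where
  d≡0 : d ≡ 0
  d≡0 = prime∣shift⇒≡0 {b = b} {t = t} pr (a≢0 ∘ n∣m⇒m%n≡0 a p) (≤-<-trans (m≤n+m d t) t'<p)
                       (m%n≡0⇒n∣m _ p root) (m%n≡0⇒n∣m _ p root')

affine-root-unique : ∀ {p} .{{_ : NonZero p}} → Prime p → ∀ {a b t t'} → a % p ≢ 0 → t < p → t' < p →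
                     (b + t * a) % p ≡ 0 → (b + t' * a) % p ≡ 0 → t ≡ t'
affine-root-unique pr {t = t} {t'} a≢0 t<p t'<p root root' with ≤-total t t'
... | inj₁ t≤t' = affine-root-unique-≤ pr a≢0 t≤t' t'<p root root'
... | inj₂ t'≤t = sym (affine-root-unique-≤ pr a≢0 t'≤t t<p root' root)

injective⇒≤∣p∣ : ∀ {k n} (S : Subset n) (f : Fin k → Fin n) →
                 Injective _≡_ _≡_ f → (∀ i → f i ∈ S) → k ≤ ∣ S ∣
injective⇒≤∣p∣ {0}     S f f-inj f∈S = z≤n
injective⇒≤∣p∣ {suc k} S f f-inj f∈S =
  ≤-<-trans (injective⇒≤∣p∣ (S - f zero) (f ∘ suc) (suc-injective ∘ f-inj) f∘suc∈S-f₀)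
            (x∈p⇒∣p-x∣<∣p∣ (f∈S zero))
  where
  f∘suc∈S-f₀ : ∀ i → f (suc i) ∈ S - f zero
  f∘suc∈S-f₀ i = x∈p∧x≢y⇒x∈p-y (f∈S (suc i)) (λ eq → 0≢1+n (sym (f-inj eq)))

orthogonal⇒n≤k*k : ∀ {n k} {S : Subset n} → HasOrthColouring S k → n ≤ k * k
orthogonal⇒n≤k*k (c₁ , c₂ , _ , _ , c₁⊥c₂) = injective⇒≤ pair-injective
  where
  pair-injective : Injective _≡_ _≡_ (λ v → combine (c₁ v) (c₂ v))
  pair-injective {u} {v} eq with u ≟ᶠ v | combine-injective (c₁ u) (c₂ u) (c₁ v) (c₂ v) eq
  ... | yes u≡v | _              = u≡v
  ... | no u≢v  | same₁ , same₂ = ⊥-elim (c₁⊥c₂ u v u≢v same₁ same₂)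

module Digits (p : ℕ) .{{_ : NonZero p}} where

  carry : ℕ → ℕ → ℕ
  carry x y = (x % p + y % p) / p

  carry≡0⊎1 : ∀ x y → carry x y ≡ 0 ⊎ carry x y ≡ 1
  carry≡0⊎1 x y with carry x y | m<n*o⇒m/o<n {n = 2} {o = p} digits<2p
    where
    digits<2p : x % p + y % p < 2 * p
    digits<2p = subst (x % p + y % p <_) (cong (p +_) (sym (+-identityʳ p)))
                      (+-mono-< (m%n<n x p) (m%n<n y p))
  ... | 0 | _ = inj₁ refl
  ... | 1 | _ = inj₂ refl
  ... | suc (suc _) | s≤s (s≤s ())

  %-+ : ∀ x y → (x + y) % p + carry x y * p ≡ x % p + y % p
  %-+ x y = begin
    (x + y) % p + carry x y * p             ≡⟨ cong (_+ carry x y * p) (%-distribˡ-+ x y p) ⟩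
    (x % p + y % p) % p + carry x y * p     ≡⟨ m≡m%n+[m/n]*n (x % p + y % p) p ⟨
    x % p + y % p                           ∎

  /-+ : ∀ x y → (x + y) / p ≡ x / p + y / p + carry x y
  /-+ x y = begin
    (x + y) / p                                   ≡⟨ cong (_/ p) (cong₂ _+_ (m≡m%n+[m/n]*n x p) (m≡m%n+[m/n]*n y p)) ⟩
    ((x % p + x / p * p) + (y % p + y / p * p)) / p ≡⟨ cong (_/ p) (regroup (x % p) (x / p) (y % p) (y / p) p) ⟩
    ((x % p + y % p) + (x / p + y / p) * p) / p   ≡⟨ +-distrib-/-∣ʳ (x % p + y % p) (n∣m*n (x / p + y / p)) ⟩
    carry x y + (x / p + y / p) * p / p           ≡⟨ cong (carry x y +_) (m*n/n≡m (x / p + y / p) p) ⟩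
    carry x y + (x / p + y / p)                   ≡⟨ +-comm (carry x y) (x / p + y / p) ⟩
    x / p + y / p + carry x y                     ∎
    where
    regroup : ∀ a b c d p → (a + b * p) + (c + d * p) ≡ (a + c) + (b + d) * p
    regroup = solve-∀

  %-periodic : ∀ x k → (x + k * (p * p)) % p ≡ x % p
  %-periodic x k = trans (cong (λ z → (x + z) % p) (sym (*-assoc k p p))) ([m+kn]%n≡m%n x (k * p) p)

  digitForm : ℕ → ℕ → ℕ
  digitForm t x = x / p + t * (x % p)

  digitForm-0 : ∀ t → digitForm t 0 ≡ 0
  digitForm-0 t = trans (cong₂ (λ b a → b + t * a) (0/n≡0 p) (m*n%n≡0 0 p)) (*-zeroʳ t)

  digitForm-+ : ∀ t x y → digitForm t (x + y) % p ≡ (digitForm t x + digitForm t y + carry x y) % p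
  digitForm-+ t x y = begin
    digitForm t (x + y) % p                                ≡⟨ [m+kn]%n≡m%n (digitForm t (x + y)) (t * c) p ⟨
    (digitForm t (x + y) + t * c * p) % p                  ≡⟨ cong (λ z → (z + t * ((x + y) % p) + t * c * p) % p) (/-+ x y) ⟩
    (x / p + y / p + c + t * ((x + y) % p) + t * c * p) % p ≡⟨ cong (_% p) (factor (x / p) (y / p) c t ((x + y) % p) p) ⟩
    (x / p + y / p + c + t * ((x + y) % p + c * p)) % p    ≡⟨ cong (λ z → (x / p + y / p + c + t * z) % p) (%-+ x y) ⟩
    (x / p + y / p + c + t * (x % p + y % p)) % p          ≡⟨ cong (_% p) (distribute (x / p) (y / p) c t (x % p) (y % p)) ⟩
    (digitForm t x + digitForm t y + c) % p                ∎
    where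
    c : ℕ
    c = carry x y
    factor : ∀ X Y c t r p → X + Y + c + t * r + t * c * p ≡ X + Y + c + t * (r + c * p)
    factor = solve-∀
    distribute : ∀ X Y c t a b → X + Y + c + t * (a + b) ≡ (X + t * a) + (Y + t * b) + c
    distribute = solve-∀

  digitForm-periodic : ∀ t x k → digitForm t (x + k * (p * p)) % p ≡ digitForm t x % p
  digitForm-periodic t x k = begin
    digitForm t (x + k * (p * p)) % p                          ≡⟨ cong (λ z → digitForm t (x + z) % p) (sym (*-assoc k p p)) ⟩
    ((x + k * p * p) / p + t * ((x + k * p * p) % p)) % p      ≡⟨ cong₂ (λ b a → (b + t * a) % p) high low ⟩
    (x / p + k * p + t * (x % p)) % p                          ≡⟨ cong (_% p) (xy∙z≈xz∙y (x / p) (k * p) (t * (x % p))) ⟩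
    (digitForm t x + k * p) % p                                ≡⟨ [m+kn]%n≡m%n (digitForm t x) k p ⟩
    digitForm t x % p                                          ∎
    where
    high : (x + k * p * p) / p ≡ x / p + k * p
    high = trans (+-distrib-/-∣ʳ x (n∣m*n (k * p))) (cong (x / p +_) (m*n/n≡m (k * p) p))
    low : (x + k * p * p) % p ≡ x % p
    low = [m+kn]%n≡m%n x (k * p) p

  digitForm-complement : ∀ t x y → x % p ≢ 0 → x + y ≡ p * p →
                         (digitForm t y + (digitForm t x + 1)) % p ≡ 0
  digitForm-complement t x y x≢0 x+y≡pp = begin
    (digitForm t y + (digitForm t x + 1)) % p              ≡⟨ cong (λ c → (digitForm t y + (digitForm t x + c)) % p) carry≡1 ⟨
    (digitForm t y + (digitForm t x + carry x y)) % p      ≡⟨ cong (_% p) (x∙yz≈yx∙z (digitForm t y) (digitForm t x) (carry x y)) ⟩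
    (digitForm t x + digitForm t y + carry x y) % p        ≡⟨ digitForm-+ t x y ⟨
    digitForm t (x + y) % p                                ≡⟨ cong (λ z → digitForm t z % p) (trans x+y≡pp (sym (+-identityʳ (p * p)))) ⟩
    digitForm t (0 + 1 * (p * p)) % p                      ≡⟨ digitForm-periodic t 0 1 ⟩
    digitForm t 0 % p                                      ≡⟨ cong (_% p) (digitForm-0 t) ⟩
    0 % p                                                  ≡⟨ m*n%n≡0 0 p ⟩
    0                                                      ∎
    where
    carry≡1 : carry x y ≡ 1
    carry≡1 with carry≡0⊎1 x y
    ... | inj₂ c≡1 = c≡1
    ... | inj₁ c≡0 = ⊥-elim (x≢0 (m+n≡0⇒m≡0 (x % p) (sym digits≡0)))
      where
      digits≡0 : 0 ≡ x % p + y % p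
      digits≡0 = trans (sym (cong₂ _+_ (trans (cong (_% p) x+y≡pp) (m*n%n≡0 p p)) (cong (_* p) c≡0))) (%-+ x y)

multiples∉⇒%≢0 : ∀ {p} .{{_ : NonZero p}} {S : Subset (p * p)} →
                 (∀ (a : Fin (p * p)) → toℕ a ≡ 0 → a ∉ S) →
                 (∀ x → 1 ≤ x → x < p → ∀ (a : Fin (p * p)) → toℕ a ≡ x * p → a ∉ S) →
                 ∀ s → s ∈ S → toℕ s % p ≢ 0
multiples∉⇒%≢0 {p} 0∉S xp∉S s s∈S s%p≡0 with toℕ s / p | m<n*o⇒m/o<n {o = p} (toℕ<n s) | s≡[s/p]*p
  where
  s≡[s/p]*p : toℕ s ≡ toℕ s / p * p
  s≡[s/p]*p = trans (m≡m%n+[m/n]*n (toℕ s) p) (cong (_+ toℕ s / p * p) s%p≡0)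
... | 0     | _   | s≡0   = 0∉S s s≡0 s∈S
... | suc x | x<p | s≡x*p = xp∉S (suc x) (s≤s z≤n) x<p s s≡x*p s∈S

module Colouring (p : ℕ) .{{_ : NonZero p}} (S : Subset (p * p)) where
  open Digits p

  lowColour : Fin (p * p) → Fin p
  lowColour v = toℕ v mod p

  skewColour : ℕ → Fin (p * p) → Fin p
  skewColour t v = digitForm t (toℕ v) mod p

  Blocked : ℕ → Set
  Blocked t = ∃ λ s → s ∈ S × digitForm t (toℕ s) % p ≡ 0

  blocked? : ∀ t → Dec (Blocked t)
  blocked? t = any? (λ s → (s ∈? S) ×-dec (digitForm t (toℕ s) % p ≟ 0))

  high<p : ∀ (v : Fin (p * p)) → toℕ v / p < p
  high<p v = m<n*o⇒m/o<n (toℕ<n v)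

  skewColour⊥lowColour : ∀ t → Orthogonal (skewColour t) lowColour
  skewColour⊥lowColour t u v u≢v same-skew same-low = u≢v (toℕ-injective (begin
    toℕ u                     ≡⟨ m≡m%n+[m/n]*n (toℕ u) p ⟩
    toℕ u % p + toℕ u / p * p ≡⟨ cong₂ (λ a b → a + b * p) low high ⟩
    toℕ v % p + toℕ v / p * p ≡⟨ m≡m%n+[m/n]*n (toℕ v) p ⟨
    toℕ v                     ∎))
    where
    low : toℕ u % p ≡ toℕ v % p
    low = mod-injective p same-low
    high%p : toℕ u / p % p ≡ toℕ v / p % p
    high%p = %-cancelʳ-+ (toℕ u / p) (toℕ v / p) (t * (toℕ v % p)) p
               (trans (cong (λ a → (toℕ u / p + t * a) % p) (sym low)) (mod-injective p same-skew))
    high : toℕ u / p ≡ toℕ v / p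
    high = trans (sym (m<n⇒m%n≡m (high<p u))) (trans high%p (m<n⇒m%n≡m (high<p v)))

  module _ (S%p≢0 : ∀ s → s ∈ S → toℕ s % p ≢ 0) where

    lowColour-proper : Proper S lowColour
    lowColour-proper u v u-v∈S same with toℕ-⊖ u v
    ... | k , u-v+v≡u+kpp = S%p≢0 (u ⊖ v) u-v∈S (trans (%-cancelʳ-+ _ 0 (toℕ v) p (begin
      (toℕ (u ⊖ v) + toℕ v) % p   ≡⟨ cong (_% p) u-v+v≡u+kpp ⟩
      (toℕ u + k * (p * p)) % p   ≡⟨ %-periodic (toℕ u) k ⟩
      toℕ u % p                   ≡⟨ mod-injective p same ⟩
      toℕ v % p                   ∎)) (m*n%n≡0 0 p))

    skewColour-proper : SymmetricSet S → ∀ t → ¬ Blocked t → Proper S (skewColour t)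
    skewColour-proper symS t unblocked u v s∈S same with toℕ-⊖ u v
    ... | k , u-v+v≡u+kpp = [ no-carry , one-carry ]′ (carry≡0⊎1 (toℕ s) (toℕ v))
      where
      s : Fin (p * p)
      s = u ⊖ v
      F : Fin (p * p) → ℕ
      F w = digitForm t (toℕ w)
      c : ℕ
      c = carry (toℕ s) (toℕ v)

      F[s]+c≡0 : (F s + c) % p ≡ 0
      F[s]+c≡0 = trans (%-cancelʳ-+ _ 0 (F v) p (begin
        (F s + c + F v) % p                    ≡⟨ cong (_% p) (xy∙z≈xz∙y (F s) c (F v)) ⟩
        (F s + F v + c) % p                    ≡⟨ digitForm-+ t (toℕ s) (toℕ v) ⟨
        digitForm t (toℕ s + toℕ v) % p        ≡⟨ cong (λ z → digitForm t z % p) u-v+v≡u+kpp ⟩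
        digitForm t (toℕ u + k * (p * p)) % p  ≡⟨ digitForm-periodic t (toℕ u) k ⟩
        F u % p                                ≡⟨ mod-injective p same ⟩
        F v % p                                ∎)) (m*n%n≡0 0 p)

      no-carry : c ≡ 0 → ⊥
      no-carry c≡0 = unblocked (s , s∈S , trans (cong (_% p) (sym F[s]+c≡F[s])) F[s]+c≡0)
        where
        F[s]+c≡F[s] : F s + c ≡ F s
        F[s]+c≡F[s] = trans (cong (F s +_) c≡0) (+-identityʳ (F s))

      one-carry : c ≡ 1 → ⊥
      one-carry c≡1 = unblocked (⊝ s , symS s s∈S , trans (%-cancelʳ-+ (F (⊝ s)) 0 (F s + 1) p
                        (trans (digitForm-complement t (toℕ s) (toℕ (⊝ s)) (S%p≢0 s s∈S) s+[-s]≡pp) (sym F[s]+1≡0)))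
                        (m*n%n≡0 0 p))
        where
        F[s]+1≡0 : (F s + 1) % p ≡ 0
        F[s]+1≡0 = subst (λ z → (F s + z) % p ≡ 0) c≡1 F[s]+c≡0
        s≢0 : toℕ s ≢ 0
        s≢0 s≡0 = S%p≢0 s s∈S (trans (cong (_% p) s≡0) (m*n%n≡0 0 p))
        s+[-s]≡pp : toℕ s + toℕ (⊝ s) ≡ p * p
        s+[-s]≡pp = trans (+-comm (toℕ s) (toℕ (⊝ s))) (toℕ-⊝ s s≢0)

    exists-unblocked : Prime p → ∣ S ∣ < p → ∃ λ (t : Fin p) → ¬ Blocked (toℕ t)
    exists-unblocked pr ∣S∣<p with all? (blocked? ∘ toℕ)
    ... | no ¬all = ¬∀⟶∃¬ p (Blocked ∘ toℕ) (blocked? ∘ toℕ) ¬all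
    ... | yes all = ⊥-elim (<⇒≱ ∣S∣<p (injective⇒≤∣p∣ S witness witness-injective witness∈S))
      where
      witness : Fin p → Fin (p * p)
      witness t = proj₁ (all t)
      witness∈S : ∀ t → witness t ∈ S
      witness∈S t = proj₁ (proj₂ (all t))
      witness-root : ∀ t → digitForm (toℕ t) (toℕ (witness t)) % p ≡ 0
      witness-root t = proj₂ (proj₂ (all t))
      witness-injective : Injective _≡_ _≡_ witness
      witness-injective {t} {t'} eq = toℕ-injective (affine-root-unique pr s₀≢0 (toℕ<n t) (toℕ<n t')
        (witness-root t) (subst (λ s → digitForm (toℕ t') (toℕ s) % p ≡ 0) (sym eq) (witness-root t')))
        where
        s₀≢0 : toℕ (witness t) % p % p ≢ 0
        s₀≢0 = S%p≢0 (witness t) (witness∈S t) ∘ trans (sym (m%n%n≡m%n _ p))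

    hasOrthColouring : Prime p → SymmetricSet S → ∣ S ∣ < p → HasOrthColouring S p
    hasOrthColouring pr symS ∣S∣<p with exists-unblocked pr ∣S∣<p
    ... | t , unblocked = skewColour (toℕ t) , lowColour
                        , skewColour-proper symS (toℕ t) unblocked , lowColour-proper
                        , skewColour⊥lowColour (toℕ t)

theorem10 : (p : ℕ) → Prime p → (S : Subset (p * p)) →
    Generates S → SymmetricSet S → (∀ (a : Fin (p * p)) → toℕ a ≡ 0 → a ∉ S) →
    ∣ S ∣ < p →
    (∀ (x : ℕ) → 1 ≤ x → x < p → ∀ (a : Fin (p * p)) → toℕ a ≡ x * p → a ∉ S) →
    OChiEq S p
theorem10 p pr S _ symS 0∉S ∣S∣<p xp∉S = upper , lower
  where
  instance
    p≢0 : NonZero p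
    p≢0 = prime⇒nonZero pr

  upper : HasOrthColouring S p
  upper = Colouring.hasOrthColouring p S (multiples∉⇒%≢0 0∉S xp∉S) pr symS ∣S∣<p

  lower : ∀ j → j < p → ¬ HasOrthColouring S j
  lower j j<p colouring = <⇒≱ (*-mono-< j<p j<p) (orthogonal⇒n≤k*k colouring)
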